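{- For every natural number $k$ and every formula $\varphi$: (1) if $\varphi \in \mathrm{E}_k^+$, then $\mathrm{PNF}(\varphi) \cap \Sigma_k^+ \neq \emptyset$; (2) if $\varphi \in \mathrm{U}_k^+$, then $\mathrm{PNF}(\varphi) \cap \Pi_k^+ \neq \emptyset$.
   Context: Fix an arbitrary first-order language whose logical symbols are $\forall, \exists, \to, \land, \lor, \perp$. $\mathrm{FV}(\varphi)$ is the set of free variables of $\varphi$. Prenex classes: $\Sigma_0 = \Pi_0$ is the class of quantifier-free formulas; $\Sigma_{k+1}$ is the class of formulas $\exists x_1 \cdots \exists x_n \varphi$ with $n \geq 1$ and $\varphi \in \Pi_k$; $\Pi_{k+1}$ is the class of formulas $\forall x_1 \cdots \forall x_n \varphi$ with $n\ge 1$ and $\varphi \in \Sigma_k$. $\Sigma_k^+ = \Sigma_k \cup \bigcup_{i<k}(\Sigma_i \cup \Pi_i)$, $\Pi_k^+ = \Pi_k \cup \bigcup_{i<k}(\Sigma_i \cup \Pi_i)$. A formula is in prenex normal form if it is in $\Sigma_k \cup \Pi_k$ for some $k$. Alternation paths: finite sequences of $+$ and $-$ in which $+$ and $-$ alternate. For such $s$, $i(s)$ is its first symbol if $s$ is nonempty and a special symbol $\times$ if $s=\langle\,\rangle$; $s^\perp$ swaps $+$ and $-$; $l(s)$ is its length; $+s$, $-s$ denote prepending. $\mathrm{Alt}(\varphi)$: if $\varphi$ is quantifier-free, $\{\langle\,\rangle\}$; otherwise $\mathrm{Alt}(\varphi_1 \land \varphi_2)=\mathrm{Alt}(\varphi_1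 \lor \varphi_2) = \mathrm{Alt}(\varphi_1)\cup\mathrm{Alt}(\varphi_2)$; $\mathrm{Alt}(\varphi_1\to\varphi_2) = \{s^\perp : s\in\mathrm{Alt}(\varphi_1)\}\cup\mathrm{Alt}(\varphi_2)$; $\mathrm{Alt}(\forall x\varphi_1) = \{s\in\mathrm{Alt}(\varphi_1): i(s)=-\}\cup\{ -s: s\in\mathrm{Alt}(\varphi_1), i(s)\neq -\}$; $\mathrm{Alt}(\exists x\varphi_1) = \{s\in\mathrm{Alt}(\varphi_1): i(s)=+\}\cup\{+s: s\in\mathrm{Alt}(\varphi_1), i(s)\neq +\}$. $\deg(\varphi)=\max\{l(s): s\in\mathrm{Alt}(\varphi)\}$. Classes: $\mathrm{F}_k=\{\varphi:\deg(\varphi)=k\}$; $\mathrm{U}_0=\mathrm{E}_0=\mathrm{F}_0$; $\mathrm{U}_{k+1}=\{\varphi\in\mathrm{F}_{k+1}: i(s)=- \text{ for all } s\in\mathrm{Alt}(\varphi) \text{ with } l(s)=k+1\}$; $\mathrm{E}_{k+1}$ likewise with $+$; $\mathrm{U}_k^+=\mathrm{U}_k\cup\bigcup_{i<k}\mathrm{F}_i$; $\mathrm{E}_k^+=\mathrm{E}_k\cup\bigcup_{i<k}\mathrm{F}_i$. Prenex transformation: $\varphi\rhd\psi$ means that for some formulas $\xi,\delta$, a variable $x\notin\mathrm{FV}(\delta)$, a variable $y$ not occurring in $\xi$, and $Q\in\{\forall,\exists\}$, $(\varphi,\psi)$ is one of: $(\exists x\xi(x)\to\delta, \forall x(\xi(x)\to\delta))$;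 $(\forall x\xi(x)\to\delta, \exists x(\xi(x)\to\delta))$; $(\delta\to Qx\,\xi(x), Qx(\delta\to\xi(x)))$; $(Qx\,\xi(x)\land\delta, Qx(\xi(x)\land\delta))$; $(\delta\land Qx\,\xi(x), Qx(\delta\land\xi(x)))$; $(Qx\,\xi(x)\lor\delta, Qx(\xi(x)\lor\delta))$; $(\delta\lor Qx\,\xi(x), Qx(\delta\lor\xi(x)))$; $(Qx\,\xi(x), Qy\,\xi(y))$, with $\xi(y)$ the substitution of $y$ for free $x$. $\varphi\rhd^*\psi$ means there are $m\ge0$ and $\varphi_0\equiv\varphi,\dots,\varphi_m\equiv\psi$ with each $\varphi_{i+1}$ obtained from $\varphi_i$ by replacing one occurrence of a subformula $\xi_i$ with $\delta_i$ where $\xi_i\rhd\delta_i$. $\mathrm{PNF}(\varphi)=\{\psi:\varphi\rhd^*\psi \text{ and } \psi \text{ is in prenex normal form}\}$. -}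

module Defs where

open import Data.Nat using (ℕ; zero; suc; _<_; _≡ᵇ_; _⊔_)
open import Data.Bool using (Bool; true; false; if_then_else_; _∧_)
open import Data.List using (List; []; _∷_; map; length; _++_; foldr)
open import Data.List.Membership.Propositional using (_∈_)
open import Data.Vec using (Vec; []; _∷_)
open import Data.Maybe using (Maybe; just; nothing)
open import Data.Product using (Σ; _×_; ∃; ∃-syntax; _,_)
open import Data.Sum using (_⊎_)
open import Relation.Nullary using (¬_)
open import Relation.Binary.PropositionalEquality using (_≡_; _≢_)
open import Relation.Binary.Construct.Closure.ReflexiveTransitive using (Star)

record Signature : Set₁ where
  field
    Fun      : Set
    funArity : Fun → ℕ
    Rel      : Set
    relArity : Rel → ℕ

Var : Set
Var = ℕ

data Sign : Set where
  plus minus : Sign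

flip : Sign → Sign
flip plus  = minus
flip minus = plus

-- i(s): first symbol, nothing standing for the special symbol ×.
Path : Set
Path = List Sign

i : Path → Maybe Sign
i []      = nothing
i (c ∷ _) = just c

_⊥ₚ : Path → Path
s ⊥ₚ = map flip s

isMinus : Maybe Sign → Bool
isMinus (just minus) = true
isMinus _            = false

isPlus : Maybe Sign → Bool
isPlus (just plus) = true
isPlus _           = false

module FOL (L : Signature) where
  open Signature L

  data Term : Set where
    var : Var → Term
    app : (f : Fun) → Vec Term (funArity f) → Term

  data Formula : Set where
    atom : (r : Rel) → Vec Term (relArity r) → Formula
    ⊥'   : Formula
    _⇒_  : Formula → Formula → Formula
    _∧'_ : Formula → Formula → Formula
    _∨'_ : Formula → Formula → Formula
    ∀'   : Var → Formula → Formula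
    ∃'   : Var → Formula → Formula

  mutual
    data _inTerm_ (x : Var) : Term → Set where
      here : x inTerm var x
      inApp : ∀ {f ts} → x inTerms ts → x inTerm app f ts

    data _inTerms_ (x : Var) : ∀ {n} → Vec Term n → Set where
      hd : ∀ {n t} {ts : Vec Term n} → x inTerm t → x inTerms (t ∷ ts)
      tl : ∀ {n t} {ts : Vec Term n} → x inTerms ts → x inTerms (t ∷ ts)

  data _∈FV_ (x : Var) : Formula → Set where
    atomFV : ∀ {r ts} → x inTerms ts → x ∈FV atom r ts
    ⇒ˡ : ∀ {a b} → x ∈FV a → x ∈FV (a ⇒ b)
    ⇒ʳ : ∀ {a b} → x ∈FV b → x ∈FV (a ⇒ b)
    ∧ˡ : ∀ {a b} → x ∈FV a → x ∈FV (a ∧' b)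
    ∧ʳ : ∀ {a b} → x ∈FV b → x ∈FV (a ∧' b)
    ∨ˡ : ∀ {a b} → x ∈FV a → x ∈FV (a ∨' b)
    ∨ʳ : ∀ {a b} → x ∈FV b → x ∈FV (a ∨' b)
    ∀FV : ∀ {y a} → x ≢ y → x ∈FV a → x ∈FV ∀' y a
    ∃FV : ∀ {y a} → x ≢ y → x ∈FV a → x ∈FV ∃' y a

  data _occursIn_ (x : Var) : Formula → Set where
    atomOcc : ∀ {r ts} → x inTerms ts → x occursIn atom r ts
    ⇒ˡ : ∀ {a b} → x occursIn a → x occursIn (a ⇒ b)
    ⇒ʳ : ∀ {a b} → x occursIn b → x occursIn (a ⇒ b)
    ∧ˡ : ∀ {a b} → x occursIn a → x occursIn (a ∧' b)
    ∧ʳ : ∀ {a b} → x occursIn b → x occursIn (a ∧' b)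
    ∨ˡ : ∀ {a b} → x occursIn a → x occursIn (a ∨' b)
    ∨ʳ : ∀ {a b} → x occursIn b → x occursIn (a ∨' b)
    ∀bind : ∀ {a} → x occursIn ∀' x a
    ∃bind : ∀ {a} → x occursIn ∃' x a
    ∀body : ∀ {y a} → x occursIn a → x occursIn ∀' y a
    ∃body : ∀ {y a} → x occursIn a → x occursIn ∃' y a

  mutual
    substT : Var → Var → Term → Term
    substT x y (var z) = if z ≡ᵇ x then var y else var z
    substT x y (app f ts) = app f (substTs x y ts)

    substTs : ∀ {n} → Var → Var → Vec Term n → Vec Term n
    substTs x y [] = []
    substTs x y (t ∷ ts) = substT x y t ∷ substTs x y ts

  _[_≔_] : Formula → Var → Var → Formula
  atom r ts [ x ≔ y ] = atom r (substTs x y ts)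
  ⊥' [ x ≔ y ] = ⊥'
  (a ⇒ b) [ x ≔ y ] = (a [ x ≔ y ]) ⇒ (b [ x ≔ y ])
  (a ∧' b) [ x ≔ y ] = (a [ x ≔ y ]) ∧' (b [ x ≔ y ])
  (a ∨' b) [ x ≔ y ] = (a [ x ≔ y ]) ∨' (b [ x ≔ y ])
  ∀' z a [ x ≔ y ] = if z ≡ᵇ x then ∀' z a else ∀' z (a [ x ≔ y ])
  ∃' z a [ x ≔ y ] = if z ≡ᵇ x then ∃' z a else ∃' z (a [ x ≔ y ])

  qf : Formula → Bool
  qf (atom _ _) = true
  qf ⊥' = true
  qf (a ⇒ b) = qf a ∧ qf b
  qf (a ∧' b) = qf a ∧ qf b
  qf (a ∨' b) = qf a ∧ qf b
  qf (∀' _ _) = false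
  qf (∃' _ _) = false

  QF : Formula → Set
  QF φ = qf φ ≡ true

  Alt : Formula → List Path
  Alt φ with qf φ
  ... | true = [] ∷ []
  Alt φ | false = alt φ
    where
    alt : Formula → List Path
    alt (a ∧' b) = Alt a ++ Alt b
    alt (a ∨' b) = Alt a ++ Alt b
    alt (a ⇒ b) = map _⊥ₚ (Alt a) ++ Alt b
    alt (∀' _ a) = map (λ s → if isMinus (i s) then s else minus ∷ s) (Alt a)
    alt (∃' _ a) = map (λ s → if isPlus (i s) then s else plus ∷ s) (Alt a)
    alt _ = [] ∷ []

  deg : Formula → ℕ
  deg φ = foldr (λ s m → length s ⊔ m) 0 (Alt φ)

  F : ℕ → Formula → Set
  F k φ = deg φ ≡ k

  U : ℕ → Formula → Set
  U zero φ = F zero φ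
  U (suc k) φ = F (suc k) φ × (∀ s → s ∈ Alt φ → length s ≡ suc k → i s ≡ just minus)

  E : ℕ → Formula → Set
  E zero φ = F zero φ
  E (suc k) φ = F (suc k) φ × (∀ s → s ∈ Alt φ → length s ≡ suc k → i s ≡ just plus)

  U⁺ : ℕ → Formula → Set
  U⁺ k φ = U k φ ⊎ (∃[ j ] (j < k × F j φ))

  E⁺ : ℕ → Formula → Set
  E⁺ k φ = E k φ ⊎ (∃[ j ] (j < k × F j φ))

  ∃s : List Var → Formula → Formula
  ∃s xs ψ = foldr ∃' ψ xs

  ∀s : List Var → Formula → Formula
  ∀s xs ψ = foldr ∀' ψ xs

  mutual
    Σₚ : ℕ → Formula → Set
    Σₚ zero φ = QF φ
    Σₚ (suc k) φ = ∃[ xs ] (xs ≢ [] × ∃[ ψ ] (φ ≡ ∃s xs ψ × Πₚ k ψ))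

    Πₚ : ℕ → Formula → Set
    Πₚ zero φ = QF φ
    Πₚ (suc k) φ = ∃[ xs ] (xs ≢ [] × ∃[ ψ ] (φ ≡ ∀s xs ψ × Σₚ k ψ))

  Σ⁺ : ℕ → Formula → Set
  Σ⁺ k φ = Σₚ k φ ⊎ (∃[ j ] (j < k × (Σₚ j φ ⊎ Πₚ j φ)))

  Π⁺ : ℕ → Formula → Set
  Π⁺ k φ = Πₚ k φ ⊎ (∃[ j ] (j < k × (Σₚ j φ ⊎ Πₚ j φ)))

  Prenex : Formula → Set
  Prenex φ = ∃[ k ] (Σₚ k φ ⊎ Πₚ k φ)

  data Quant : Set where
    qall qex : Quant

  Q : Quant → Var → Formula → Formula
  Q qall = ∀'
  Q qex  = ∃'

  data _▷_ : Formula → Formula → Set where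
    r1 : ∀ {x ξ δ} → ¬ (x ∈FV δ) → (∃' x ξ ⇒ δ) ▷ ∀' x (ξ ⇒ δ)
    r2 : ∀ {x ξ δ} → ¬ (x ∈FV δ) → (∀' x ξ ⇒ δ) ▷ ∃' x (ξ ⇒ δ)
    r3 : ∀ {q x ξ δ} → ¬ (x ∈FV δ) → (δ ⇒ Q q x ξ) ▷ Q q x (δ ⇒ ξ)
    r4 : ∀ {q x ξ δ} → ¬ (x ∈FV δ) → (Q q x ξ ∧' δ) ▷ Q q x (ξ ∧' δ)
    r5 : ∀ {q x ξ δ} → ¬ (x ∈FV δ) → (δ ∧' Q q x ξ) ▷ Q q x (δ ∧' ξ)
    r6 : ∀ {q x ξ δ} → ¬ (x ∈FV δ) → (Q q x ξ ∨' δ) ▷ Q q x (ξ ∨' δ)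
    r7 : ∀ {q x ξ δ} → ¬ (x ∈FV δ) → (δ ∨' Q q x ξ) ▷ Q q x (δ ∨' ξ)
    r8 : ∀ {q x y ξ} → ¬ (y occursIn ξ) → Q q x ξ ▷ Q q y (ξ [ x ≔ y ])

  data _⟶_ : Formula → Formula → Set where
    base : ∀ {a b} → a ▷ b → a ⟶ b
    ⇒ˡ : ∀ {a a' b} → a ⟶ a' → (a ⇒ b) ⟶ (a' ⇒ b)
    ⇒ʳ : ∀ {a b b'} → b ⟶ b' → (a ⇒ b) ⟶ (a ⇒ b')
    ∧ˡ : ∀ {a a' b} → a ⟶ a' → (a ∧' b) ⟶ (a' ∧' b)
    ∧ʳ : ∀ {a b b'} → b ⟶ b' → (a ∧' b) ⟶ (a ∧' b')
    ∨ˡ : ∀ {a a' b} → a ⟶ a' → (a ∨' b) ⟶ (a' ∨' b)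
    ∨ʳ : ∀ {a b b'} → b ⟶ b' → (a ∨' b) ⟶ (a ∨' b')
    ∀c : ∀ {x a a'} → a ⟶ a' → ∀' x a ⟶ ∀' x a'
    ∃c : ∀ {x a a'} → a ⟶ a' → ∃' x a ⟶ ∃' x a'

  _▷*_ : Formula → Formula → Set
  _▷*_ = Star _⟶_

  _∈PNF_ : Formula → Formula → Set
  ψ ∈PNF φ = φ ▷* ψ × Prenex ψ

-- Read the alternation paths of a formula as sign sequences, and say that a
-- sequence fits (c, n) when it splits into at most n blocks of equal signs,
-- alternating and starting with c: these are exactly the quantifier prefixes
-- of Σₙ⁺ (c = +) and Πₙ⁺ (c = −) formulas. Since alternation paths alternate,
-- E⁺ₖ (U⁺ₖ) says that every alternation path of φ fits (+, k) ((−, k)).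
-- By induction on φ, if every alternation path of φ fits (c, n) then φ
-- reduces to a prenex formula whose prefix fits (c, n). A quantifier adds one
-- sign to the prefix of its body. For a binary connective the prefixes of the
-- two prenex operands are merged greedily: pull out (after renaming) any
-- leading quantifier that leaves with the current sign c, from either side;
-- when there is none, both remaining prefixes fit the next block.

module Submission where

open import Defs
open import Data.Nat using (ℕ; zero; suc; _≤_; _<_; z≤n; s≤s; _⊔_; _≡ᵇ_)
open import Data.Nat.Properties
  using (≤-trans; ≤-refl; <⇒≤; ≤-<-trans; <-irrefl; 1+n≰n; m≤n⇒m≤1+n; m≤m⊔n; m≤n⇒m≤n⊔o; m≤n⇒m≤o⊔n; m≤n⇒m<n∨m≡n)
open import Data.Bool using (true; false; if_then_else_; _∧_)
open import Data.List using ([]; _∷_; map; length; foldr)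
open import Data.List.Membership.Propositional using (_∈_)
open import Data.List.Membership.Propositional.Properties using (∈-map⁺; ∈-++⁺ˡ; ∈-++⁺ʳ)
open import Data.List.Relation.Unary.Any using (here; there)
open import Data.List.Relation.Unary.All as All using (All; []; _∷_; lookup)
open import Data.List.Relation.Unary.All.Properties using (++⁺; ++⁻ˡ; ++⁻ʳ; map⁺; map⁻)
open import Data.Maybe.Properties using (just-injective)
open import Data.Vec using (Vec; []; _∷_)
open import Data.Product as Product using (_×_; ∃-syntax; _,_)
open import Data.Sum using (_⊎_; inj₁; inj₂)
open import Data.Empty using (⊥-elim)
open import Function using (_∘_)
open import Function.Bundles using (_⇔_; mk⇔; Equivalence)
open import Function.Construct.Composition using (_⇔-∘_)
open import Relation.Nullary using (¬_; Dec; yes; no)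
open import Relation.Binary.PropositionalEquality using (_≡_; _≢_; refl; sym; trans; cong; cong₂; subst)
open import Relation.Binary.Construct.Closure.ReflexiveTransitive using (ε; _◅_; _◅◅_; gmap)

_≟ˢ_ : (c d : Sign) → Dec (c ≡ d)
plus  ≟ˢ plus  = yes refl
plus  ≟ˢ minus = no λ ()
minus ≟ˢ plus  = no λ ()
minus ≟ˢ minus = yes refl

≢⇒≡flip : ∀ {c d} → d ≢ c → d ≡ flip c
≢⇒≡flip {plus}  {plus}  d≢c = ⊥-elim (d≢c refl)
≢⇒≡flip {plus}  {minus} _   = refl
≢⇒≡flip {minus} {plus}  _   = refl
≢⇒≡flip {minus} {minus} d≢c = ⊥-elim (d≢c refl)

map-flip-involutive : ∀ s → map flip (map flip s) ≡ s
map-flip-involutive []          = refl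
map-flip-involutive (plus ∷ s)  = cong (plus ∷_) (map-flip-involutive s)
map-flip-involutive (minus ∷ s) = cong (minus ∷_) (map-flip-involutive s)

-- Blocks may be empty, so Fits c n p also covers the prefixes with fewer
-- than n blocks, or with n blocks of which the first has the other sign.
data Fits : Sign → ℕ → Path → Set where
  nil    : ∀ {c n} → Fits c n []
  same   : ∀ {c n p} → Fits c (suc n) p → Fits c (suc n) (c ∷ p)
  switch : ∀ {c n p} → Fits (flip c) n p → Fits c (suc n) p

Fits-tail : ∀ {c n d s} → Fits c n (d ∷ s) → Fits c n s
Fits-tail (same f)   = f
Fits-tail (switch f) = switch (Fits-tail f)

Fits-dup : ∀ {c n d s} → Fits c n (d ∷ s) → Fits c n (d ∷ d ∷ s)
Fits-dup (same f)   = same (same f)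
Fits-dup (switch f) = switch (Fits-dup f)

Fits-map-flip : ∀ {c n s} → Fits c n s → Fits (flip c) n (map flip s)
Fits-map-flip nil        = nil
Fits-map-flip (same f)   = same (Fits-map-flip f)
Fits-map-flip (switch f) = switch (Fits-map-flip f)

Fits-map-flip⁻ : ∀ {c n s} → Fits c n (map flip s) → Fits (flip c) n s
Fits-map-flip⁻ {c} {n} {s} f = subst (Fits (flip c) n) (map-flip-involutive s) (Fits-map-flip f)

Fits-switch-≢ : ∀ {c d n p} → d ≢ c → Fits d n p → Fits c (suc n) p
Fits-switch-≢ d≢c f = switch (subst (λ e → Fits e _ _) (≢⇒≡flip d≢c) f)

Fits-∷-≢ : ∀ {c d n s} → d ≢ c → Fits c (suc n) (d ∷ s) → Fits d n (d ∷ s)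
Fits-∷-≢ d≢c (same _)   = ⊥-elim (d≢c refl)
Fits-∷-≢ d≢c (switch f) = subst (λ e → Fits e _ _) (sym (≢⇒≡flip d≢c)) f

Fits-∷-residual : ∀ {c n d s₀} → Fits c n (d ∷ s₀) → ∃[ m ] (∀ {s} → Fits c n (d ∷ s) ⇔ Fits d (suc m) s)
Fits-∷-residual {n = zero} ()
Fits-∷-residual {c} {suc n} {d} f with d ≟ˢ c
... | yes refl = n , mk⇔ Fits-tail same
... | no d≢c with Fits-∷-residual (Fits-∷-≢ d≢c f)
...   | m , residual = m , residual ⇔-∘ mk⇔ (Fits-∷-≢ d≢c) (Fits-switch-≢ d≢c)

data Alternating : Path → Set where
  empty  : Alternating []
  single : ∀ d → Alternating (d ∷ [])
  cons   : ∀ d {s} → Alternating (flip d ∷ s) → Alternating (d ∷ flip d ∷ s)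

Alternating-map-flip : ∀ {s} → Alternating s → Alternating (map flip s)
Alternating-map-flip empty      = empty
Alternating-map-flip (single d) = single (flip d)
Alternating-map-flip (cons d a) = cons (flip d) (Alternating-map-flip a)

Fits-alternating : ∀ {d s n} → Alternating (d ∷ s) → length (d ∷ s) ≤ n → Fits d n (d ∷ s)
Fits-alternating (single d) (s≤s _)  = same nil
Fits-alternating (cons d a) (s≤s le) = same (switch (Fits-alternating a le))

Fits-bounded : ∀ {c n d s} → Alternating (d ∷ s) → length (d ∷ s) ≤ n
             → (length (d ∷ s) ≡ n → d ≡ c) → Fits c n (d ∷ s)
Fits-bounded {c} {d = d} a le top with d ≟ˢ c
... | yes refl = Fits-alternating a le
... | no d≢c with m≤n⇒m<n∨m≡n le
...   | inj₁ (s≤s lt) = Fits-switch-≢ d≢c (Fits-alternating a lt)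
...   | inj₂ eq       = ⊥-elim (d≢c (top eq))

-- Alt (∀' x φ) = map (push minus) (Alt φ) and Alt (∃' x φ) = map (push plus) (Alt φ).
push : Sign → Path → Path
push minus s = if isMinus (i s) then s else minus ∷ s
push plus  s = if isPlus (i s) then s else plus ∷ s

Fits-push : ∀ d {c n s} → Fits c n (push d s) → Fits c n (d ∷ s)
Fits-push minus {s = []}        f = f
Fits-push minus {s = minus ∷ _} f = Fits-dup f
Fits-push minus {s = plus ∷ _}  f = f
Fits-push plus  {s = []}        f = f
Fits-push plus  {s = plus ∷ _}  f = Fits-dup f
Fits-push plus  {s = minus ∷ _} f = f

Alternating-push : ∀ d {s} → Alternating s → Alternating (push d s)
Alternating-push minus {[]}        _ = single minus
Alternating-push minus {minus ∷ _} a = a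
Alternating-push minus {plus ∷ _}  a = cons minus a
Alternating-push plus  {[]}        _ = single plus
Alternating-push plus  {plus ∷ _}  a = a
Alternating-push plus  {minus ∷ _} a = cons plus a

switches : Sign → Path → ℕ
switches d [] = 0
switches d (e ∷ p) with d ≟ˢ e
... | yes _ = switches e p
... | no  _ = suc (switches e p)

switches-fits : ∀ {c n d p} → Fits c n (d ∷ p) → suc (switches d p) ≤ n
switches-fits-≢ : ∀ {c n d p} → d ≢ c → Fits c n (d ∷ p) → suc (switches d p) < n

switches-fits (same {p = []} f) = s≤s z≤n
switches-fits {c} (same {p = e ∷ p} f) with c ≟ˢ e
... | yes refl = switches-fits f
... | no c≢e   = switches-fits-≢ (c≢e ∘ sym) f
switches-fits (switch f) = m≤n⇒m≤1+n (switches-fits f)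

switches-fits-≢ d≢c (same f)   = ⊥-elim (d≢c refl)
switches-fits-≢ d≢c (switch f) = s≤s (switches-fits f)

∈⇒length≤max : ∀ {s : Path} {ss} → s ∈ ss → length s ≤ foldr (λ s m → length s ⊔ m) 0 ss
∈⇒length≤max (here refl) = m≤m⊔n _ _
∈⇒length≤max {ss = s′ ∷ _} (there s∈) = m≤n⇒m≤o⊔n (length s′) (∈⇒length≤max s∈)

module PrenexNormalForm (L : Signature) where
  open FOL L

  quant : Sign → Quant
  quant plus  = qex
  quant minus = qall

  Qˢ : Sign → Var → Formula → Formula
  Qˢ d = Q (quant d)

  Qˢ-cong : ∀ d x {a b} → a ⟶ b → Qˢ d x a ⟶ Qˢ d x b
  Qˢ-cong plus  x = ∃c
  Qˢ-cong minus x = ∀c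

  data HasPrefix : Path → Formula → Set where
    matrix     : ∀ {φ} → QF φ → HasPrefix [] φ
    quantified : ∀ {p φ} d x → HasPrefix p φ → HasPrefix (d ∷ p) (Qˢ d x φ)

  record PrenexForm (c : Sign) (n : ℕ) (φ : Formula) : Set where
    constructor prenexForm
    field
      form    : Formula
      prefix  : Path
      reduces : φ ▷* form
      prenex  : HasPrefix prefix form
      fits    : Fits c n prefix

  PrenexForm-QF : ∀ {c n φ} → QF φ → PrenexForm c n φ
  PrenexForm-QF q = prenexForm _ [] ε (matrix q) nil

  ▷*-PrenexForm : ∀ {c n φ φ′} → φ ▷* φ′ → PrenexForm c n φ′ → PrenexForm c n φ
  ▷*-PrenexForm r (prenexForm ψ p r′ P f) = prenexForm ψ p (r ◅◅ r′) P f

  PrenexForm-switch : ∀ {c n φ} → PrenexForm (flip c) n φ → PrenexForm c (suc n) φ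
  PrenexForm-switch (prenexForm ψ p r P f) = prenexForm ψ p r P (switch f)

  quantify : ∀ d x {c n c′ n′ φ} → (∀ {p} → Fits c n p → Fits c′ n′ (d ∷ p))
           → PrenexForm c n φ → PrenexForm c′ n′ (Qˢ d x φ)
  quantify d x extend (prenexForm ψ p r P f) =
    prenexForm (Qˢ d x ψ) (d ∷ p) (gmap (Qˢ d x) (Qˢ-cong d x) r) (quantified d x P) (extend f)

  maxVarᵗ : Term → ℕ
  maxVarᵗˢ : ∀ {n} → Vec Term n → ℕ

  maxVarᵗ (var x)    = x
  maxVarᵗ (app f ts) = maxVarᵗˢ ts

  maxVarᵗˢ []       = 0
  maxVarᵗˢ (t ∷ ts) = maxVarᵗ t ⊔ maxVarᵗˢ ts

  maxVar : Formula → ℕ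
  maxVar (atom r ts) = maxVarᵗˢ ts
  maxVar ⊥'          = 0
  maxVar (a ⇒ b)     = maxVar a ⊔ maxVar b
  maxVar (a ∧' b)    = maxVar a ⊔ maxVar b
  maxVar (a ∨' b)    = maxVar a ⊔ maxVar b
  maxVar (∀' x a)    = x ⊔ maxVar a
  maxVar (∃' x a)    = x ⊔ maxVar a

  inTerm⇒≤ : ∀ {x t} → x inTerm t → x ≤ maxVarᵗ t
  inTerms⇒≤ : ∀ {x n} {ts : Vec Term n} → x inTerms ts → x ≤ maxVarᵗˢ ts

  inTerm⇒≤ here      = ≤-refl
  inTerm⇒≤ (inApp o) = inTerms⇒≤ o

  inTerms⇒≤ {ts = t ∷ ts} (hd o) = m≤n⇒m≤n⊔o (maxVarᵗˢ ts) (inTerm⇒≤ o)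
  inTerms⇒≤ {ts = t ∷ ts} (tl o) = m≤n⇒m≤o⊔n (maxVarᵗ t) (inTerms⇒≤ o)

  occurs⇒≤maxVar : ∀ {x φ} → x occursIn φ → x ≤ maxVar φ
  occurs⇒≤maxVar (atomOcc o)            = inTerms⇒≤ o
  occurs⇒≤maxVar {φ = _ ⇒ b}  (⇒ˡ o)    = m≤n⇒m≤n⊔o (maxVar b) (occurs⇒≤maxVar o)
  occurs⇒≤maxVar {φ = a ⇒ _}  (⇒ʳ o)    = m≤n⇒m≤o⊔n (maxVar a) (occurs⇒≤maxVar o)
  occurs⇒≤maxVar {φ = _ ∧' b} (∧ˡ o)    = m≤n⇒m≤n⊔o (maxVar b) (occurs⇒≤maxVar o)
  occurs⇒≤maxVar {φ = a ∧' _} (∧ʳ o)    = m≤n⇒m≤o⊔n (maxVar a) (occurs⇒≤maxVar o)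
  occurs⇒≤maxVar {φ = _ ∨' b} (∨ˡ o)    = m≤n⇒m≤n⊔o (maxVar b) (occurs⇒≤maxVar o)
  occurs⇒≤maxVar {φ = a ∨' _} (∨ʳ o)    = m≤n⇒m≤o⊔n (maxVar a) (occurs⇒≤maxVar o)
  occurs⇒≤maxVar {φ = ∀' _ a} ∀bind     = m≤m⊔n _ (maxVar a)
  occurs⇒≤maxVar {φ = ∃' _ a} ∃bind     = m≤m⊔n _ (maxVar a)
  occurs⇒≤maxVar {φ = ∀' y _} (∀body o) = m≤n⇒m≤o⊔n y (occurs⇒≤maxVar o)
  occurs⇒≤maxVar {φ = ∃' y _} (∃body o) = m≤n⇒m≤o⊔n y (occurs⇒≤maxVar o)

  ∈FV⇒occurs : ∀ {x φ} → x ∈FV φ → x occursIn φ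
  ∈FV⇒occurs (atomFV o)  = atomOcc o
  ∈FV⇒occurs (⇒ˡ o)      = ⇒ˡ (∈FV⇒occurs o)
  ∈FV⇒occurs (⇒ʳ o)      = ⇒ʳ (∈FV⇒occurs o)
  ∈FV⇒occurs (∧ˡ o)      = ∧ˡ (∈FV⇒occurs o)
  ∈FV⇒occurs (∧ʳ o)      = ∧ʳ (∈FV⇒occurs o)
  ∈FV⇒occurs (∨ˡ o)      = ∨ˡ (∈FV⇒occurs o)
  ∈FV⇒occurs (∨ʳ o)      = ∨ʳ (∈FV⇒occurs o)
  ∈FV⇒occurs (∀FV _ o)   = ∀body (∈FV⇒occurs o)
  ∈FV⇒occurs (∃FV _ o)   = ∃body (∈FV⇒occurs o)

  fresh : (A B : Formula) → ∃[ y ] (¬ y occursIn A × ¬ y ∈FV B)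
  fresh A B = suc (maxVar A ⊔ maxVar B)
            , (λ o → 1+n≰n (m≤n⇒m≤n⊔o (maxVar B) (occurs⇒≤maxVar o)))
            , (λ o → 1+n≰n (m≤n⇒m≤o⊔n (maxVar A) (occurs⇒≤maxVar (∈FV⇒occurs o))))

  qf-[≔] : ∀ φ x y → qf (φ [ x ≔ y ]) ≡ qf φ
  qf-[≔] (atom r ts) x y = refl
  qf-[≔] ⊥'          x y = refl
  qf-[≔] (a ⇒ b)     x y = cong₂ _∧_ (qf-[≔] a x y) (qf-[≔] b x y)
  qf-[≔] (a ∧' b)    x y = cong₂ _∧_ (qf-[≔] a x y) (qf-[≔] b x y)
  qf-[≔] (a ∨' b)    x y = cong₂ _∧_ (qf-[≔] a x y) (qf-[≔] b x y)
  qf-[≔] (∀' z a)    x y with z ≡ᵇ x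
  ... | true  = refl
  ... | false = refl
  qf-[≔] (∃' z a)    x y with z ≡ᵇ x
  ... | true  = refl
  ... | false = refl

  HasPrefix-[≔] : ∀ x y {p φ} → HasPrefix p φ → HasPrefix p (φ [ x ≔ y ])
  HasPrefix-[≔] x y {φ = φ} (matrix q) = matrix (trans (qf-[≔] φ x y) q)
  HasPrefix-[≔] x y (quantified plus z P) with z ≡ᵇ x
  ... | true  = quantified plus z P
  ... | false = quantified plus z (HasPrefix-[≔] x y P)
  HasPrefix-[≔] x y (quantified minus z P) with z ≡ᵇ x
  ... | true  = quantified minus z P
  ... | false = quantified minus z (HasPrefix-[≔] x y P)

  data Connective : Set where
    ∧ᶜ ∨ᶜ ⇒ᶜ : Connective

  _⟨_⟩_ : Formula → Connective → Formula → Formula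
  a ⟨ ∧ᶜ ⟩ b = a ∧' b
  a ⟨ ∨ᶜ ⟩ b = a ∨' b
  a ⟨ ⇒ᶜ ⟩ b = a ⇒ b

  -- A quantifier of sign polarity o d in the left operand leaves as one of sign d.
  polarity : Connective → Sign → Sign
  polarity ∧ᶜ c = c
  polarity ∨ᶜ c = c
  polarity ⇒ᶜ c = flip c

  Fits-polarity-flip : ∀ o {c n p} → Fits (flip (polarity o c)) n p → Fits (polarity o (flip c)) n p
  Fits-polarity-flip ∧ᶜ f = f
  Fits-polarity-flip ∨ᶜ f = f
  Fits-polarity-flip ⇒ᶜ f = f

  QF-⟨⟩ : ∀ o {a b} → QF a → QF b → QF (a ⟨ o ⟩ b)
  QF-⟨⟩ ∧ᶜ qa qb = cong₂ _∧_ qa qb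
  QF-⟨⟩ ∨ᶜ qa qb = cong₂ _∧_ qa qb
  QF-⟨⟩ ⇒ᶜ qa qb = cong₂ _∧_ qa qb

  ⟨⟩-congˡ : ∀ o {a a′ b} → a ⟶ a′ → (a ⟨ o ⟩ b) ⟶ (a′ ⟨ o ⟩ b)
  ⟨⟩-congˡ ∧ᶜ = ∧ˡ
  ⟨⟩-congˡ ∨ᶜ = ∨ˡ
  ⟨⟩-congˡ ⇒ᶜ = ⇒ˡ

  ⟨⟩-congʳ : ∀ o {a b b′} → b ⟶ b′ → (a ⟨ o ⟩ b) ⟶ (a ⟨ o ⟩ b′)
  ⟨⟩-congʳ ∧ᶜ = ∧ʳ
  ⟨⟩-congʳ ∨ᶜ = ∨ʳ
  ⟨⟩-congʳ ⇒ᶜ = ⇒ʳ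

  ▷*-⟨⟩ : ∀ o {a a′ b b′} → a ▷* a′ → b ▷* b′ → (a ⟨ o ⟩ b) ▷* (a′ ⟨ o ⟩ b′)
  ▷*-⟨⟩ o ra rb = gmap (_⟨ o ⟩ _) (⟨⟩-congˡ o) ra ◅◅ gmap (_ ⟨ o ⟩_) (⟨⟩-congʳ o) rb

  pull-outˡ : ∀ o d {x ξ δ} → ¬ x ∈FV δ → (Qˢ (polarity o d) x ξ ⟨ o ⟩ δ) ▷ Qˢ d x (ξ ⟨ o ⟩ δ)
  pull-outˡ ∧ᶜ d     = r4 {q = quant d}
  pull-outˡ ∨ᶜ d     = r6 {q = quant d}
  pull-outˡ ⇒ᶜ plus  = r2
  pull-outˡ ⇒ᶜ minus = r1

  pull-outʳ : ∀ o d {x ξ δ} → ¬ x ∈FV δ → (δ ⟨ o ⟩ Qˢ d x ξ) ▷ Qˢ d x (δ ⟨ o ⟩ ξ)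
  pull-outʳ ∧ᶜ d = r5 {q = quant d}
  pull-outʳ ∨ᶜ d = r7 {q = quant d}
  pull-outʳ ⇒ᶜ d = r3 {q = quant d}

  pullˡ : ∀ o {c m x A B} → (∀ y → PrenexForm c (suc m) ((A [ x ≔ y ]) ⟨ o ⟩ B))
        → PrenexForm c (suc m) (Qˢ (polarity o c) x A ⟨ o ⟩ B)
  pullˡ o {c} {A = A} {B} rest with fresh A B
  ... | y , y∉A , y∉B =
    ▷*-PrenexForm (⟨⟩-congˡ o (base (r8 {q = quant (polarity o c)} y∉A)) ◅ base (pull-outˡ o c y∉B) ◅ ε)
                  (quantify c y same (rest y))

  pullʳ : ∀ o {c m x A B} → (∀ y → PrenexForm c (suc m) (A ⟨ o ⟩ (B [ x ≔ y ])))
        → PrenexForm c (suc m) (A ⟨ o ⟩ Qˢ c x B)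
  pullʳ o {c} {A = A} {B} rest with fresh B A
  ... | y , y∉B , y∉A =
    ▷*-PrenexForm (⟨⟩-congʳ o (base (r8 {q = quant c} y∉B)) ◅ base (pull-outʳ o c y∉A) ◅ ε)
                  (quantify c y same (rest y))

  -- Recursion is on the Fits derivations: renaming changes the operands but not their prefixes.
  merge : ∀ o {c n pa pb A B} → Fits (polarity o c) n pa → Fits c n pb
        → HasPrefix pa A → HasPrefix pb B → PrenexForm c n (A ⟨ o ⟩ B)
  merge o (same fa) fb (quantified _ x PA) PB = pullˡ o λ y → merge o fa fb (HasPrefix-[≔] x y PA) PB
  merge o fa (same fb) PA (quantified _ x PB) = pullʳ o λ y → merge o fa fb PA (HasPrefix-[≔] x y PB)
  merge o nil nil (matrix qa) (matrix qb) = PrenexForm-QF (QF-⟨⟩ o qa qb)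
  merge o nil (switch fb) PA PB = PrenexForm-switch (merge o nil fb PA PB)
  merge o (switch fa) nil PA PB = PrenexForm-switch (merge o (Fits-polarity-flip o fa) nil PA PB)
  merge o (switch fa) (switch fb) PA PB = PrenexForm-switch (merge o (Fits-polarity-flip o fa) fb PA PB)

  combine : ∀ o {c n a b} → PrenexForm (polarity o c) n a → PrenexForm c n b → PrenexForm c n (a ⟨ o ⟩ b)
  combine o (prenexForm _ _ ra PA fa) (prenexForm _ _ rb PB fb) = ▷*-PrenexForm (▷*-⟨⟩ o ra rb) (merge o fa fb PA PB)

  Alt-nonempty : ∀ φ → ∃[ s ] (s ∈ Alt φ)
  Alt-nonempty (atom _ _) = [] , here refl
  Alt-nonempty ⊥'         = [] , here refl
  Alt-nonempty (a ⇒ b) with qf a ∧ qf b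
  ... | true  = [] , here refl
  ... | false = Product.map₂ (∈-++⁺ʳ _) (Alt-nonempty b)
  Alt-nonempty (a ∧' b) with qf a ∧ qf b
  ... | true  = [] , here refl
  ... | false = Product.map₂ ∈-++⁺ˡ (Alt-nonempty a)
  Alt-nonempty (a ∨' b) with qf a ∧ qf b
  ... | true  = [] , here refl
  ... | false = Product.map₂ ∈-++⁺ˡ (Alt-nonempty a)
  Alt-nonempty (∀' _ a) = Product.map (push minus) (∈-map⁺ (push minus)) (Alt-nonempty a)
  Alt-nonempty (∃' _ a) = Product.map (push plus) (∈-map⁺ (push plus)) (Alt-nonempty a)

  Alt-alternating : ∀ φ → All Alternating (Alt φ)
  Alt-alternating (atom _ _) = empty ∷ []
  Alt-alternating ⊥'         = empty ∷ []
  Alt-alternating (a ⇒ b) with qf a ∧ qf b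
  ... | true  = empty ∷ []
  ... | false = ++⁺ (map⁺ (All.map Alternating-map-flip (Alt-alternating a))) (Alt-alternating b)
  Alt-alternating (a ∧' b) with qf a ∧ qf b
  ... | true  = empty ∷ []
  ... | false = ++⁺ (Alt-alternating a) (Alt-alternating b)
  Alt-alternating (a ∨' b) with qf a ∧ qf b
  ... | true  = empty ∷ []
  ... | false = ++⁺ (Alt-alternating a) (Alt-alternating b)
  Alt-alternating (∀' _ a) = map⁺ (All.map (Alternating-push minus) (Alt-alternating a))
  Alt-alternating (∃' _ a) = map⁺ (All.map (Alternating-push plus) (Alt-alternating a))

  fits⇒PrenexForm-Qˢ : ∀ d x {a c n} → (∀ {c′ n′} → All (Fits c′ n′) (Alt a) → PrenexForm c′ n′ a)
                     → All (λ s → Fits c n (d ∷ s)) (Alt a) → PrenexForm c n (Qˢ d x a)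
  fits⇒PrenexForm-Qˢ d x {a} ih h with Alt-nonempty a
  ... | s , s∈ with Fits-∷-residual (lookup h s∈)
  ... | m , residual = quantify d x (Equivalence.from residual) (ih (All.map (Equivalence.to residual) h))

  fits⇒PrenexForm : ∀ φ {c n} → All (Fits c n) (Alt φ) → PrenexForm c n φ
  fits⇒PrenexForm (atom _ _) _ = PrenexForm-QF refl
  fits⇒PrenexForm ⊥'         _ = PrenexForm-QF refl
  fits⇒PrenexForm (a ⇒ b) h with qf a ∧ qf b in qf-φ
  ... | true  = PrenexForm-QF qf-φ
  ... | false = combine ⇒ᶜ (fits⇒PrenexForm a (All.map Fits-map-flip⁻ (map⁻ (++⁻ˡ _ h))))
                           (fits⇒PrenexForm b (++⁻ʳ _ h))
  fits⇒PrenexForm (a ∧' b) h with qf a ∧ qf b in qf-φ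
  ... | true  = PrenexForm-QF qf-φ
  ... | false = combine ∧ᶜ (fits⇒PrenexForm a (++⁻ˡ _ h)) (fits⇒PrenexForm b (++⁻ʳ _ h))
  fits⇒PrenexForm (a ∨' b) h with qf a ∧ qf b in qf-φ
  ... | true  = PrenexForm-QF qf-φ
  ... | false = combine ∨ᶜ (fits⇒PrenexForm a (++⁻ˡ _ h)) (fits⇒PrenexForm b (++⁻ʳ _ h))
  fits⇒PrenexForm (∀' x a) h =
    fits⇒PrenexForm-Qˢ minus x (fits⇒PrenexForm a) (All.map (Fits-push minus) (map⁻ {f = push minus} h))
  fits⇒PrenexForm (∃' x a) h =
    fits⇒PrenexForm-Qˢ plus x (fits⇒PrenexForm a) (All.map (Fits-push plus) (map⁻ {f = push plus} h))

  Class : Sign → ℕ → Formula → Set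
  Class plus  = Σₚ
  Class minus = Πₚ

  Class⁺ : Sign → ℕ → Formula → Set
  Class⁺ c k φ = Class c k φ ⊎ ∃[ j ] (j < k × (Σₚ j φ ⊎ Πₚ j φ))

  Class-zero : ∀ d {φ} → QF φ → Class d 0 φ
  Class-zero plus  q = q
  Class-zero minus q = q

  Class⇒ΣΠ : ∀ d {k φ} → Class d k φ → Σₚ k φ ⊎ Πₚ k φ
  Class⇒ΣΠ plus  = inj₁
  Class⇒ΣΠ minus = inj₂

  Class-new : ∀ d x {k φ} → Class (flip d) k φ → Class d (suc k) (Qˢ d x φ)
  Class-new plus  x cl = x ∷ [] , (λ ()) , _ , refl , cl
  Class-new minus x cl = x ∷ [] , (λ ()) , _ , refl , cl

  Class-extend : ∀ d x {k φ} → Class d (suc k) φ → Class d (suc k) (Qˢ d x φ)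
  Class-extend plus  x (xs , _ , ψ , refl , cl) = x ∷ xs , (λ ()) , ψ , refl , cl
  Class-extend minus x (xs , _ , ψ , refl , cl) = x ∷ xs , (λ ()) , ψ , refl , cl

  HasPrefix⇒Class : ∀ {d p ψ} → HasPrefix (d ∷ p) ψ → Class d (suc (switches d p)) ψ
  HasPrefix⇒Class (quantified d x (matrix q)) = Class-new d x (Class-zero (flip d) q)
  HasPrefix⇒Class (quantified d x P@(quantified e _ _)) with d ≟ˢ e
  ... | yes refl = Class-extend d x (HasPrefix⇒Class P)
  ... | no d≢e   = Class-new d x (subst (λ f → Class f _ _) (≢⇒≡flip (d≢e ∘ sym)) (HasPrefix⇒Class P))

  HasPrefix⇒Prenex : ∀ {p ψ} → HasPrefix p ψ → Prenex ψ
  HasPrefix⇒Prenex (matrix q)           = 0 , inj₁ q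
  HasPrefix⇒Prenex P@(quantified d _ _) = _ , Class⇒ΣΠ d (HasPrefix⇒Class P)

  Class⁺-intro : ∀ {c d k n ψ} → Class d k ψ → k ≤ n → (d ≢ c → k < n) → Class⁺ c n ψ
  Class⁺-intro {c} {d} cl k≤n strict with m≤n⇒m<n∨m≡n k≤n
  ... | inj₁ k<n = inj₂ (_ , k<n , Class⇒ΣΠ d cl)
  ... | inj₂ refl with d ≟ˢ c
  ...   | yes refl = inj₁ cl
  ...   | no d≢c   = ⊥-elim (<-irrefl refl (strict d≢c))

  HasPrefix⇒Class⁺ : ∀ {c n p ψ} → HasPrefix p ψ → Fits c n p → Class⁺ c n ψ
  HasPrefix⇒Class⁺ {c} {zero}  (matrix q) _ = inj₁ (Class-zero c q)
  HasPrefix⇒Class⁺ {c} {suc n} (matrix q) _ = inj₂ (0 , s≤s z≤n , inj₁ q)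
  HasPrefix⇒Class⁺ P@(quantified _ _ _) f =
    Class⁺-intro (HasPrefix⇒Class P) (switches-fits f) (λ d≢c → switches-fits-≢ d≢c f)

  EU : Sign → ℕ → Formula → Set
  EU plus  = E
  EU minus = U

  EU⁺ : Sign → ℕ → Formula → Set
  EU⁺ c k φ = EU c k φ ⊎ ∃[ j ] (j < k × F j φ)

  EU-deg : ∀ c k {φ} → EU c k φ → deg φ ≡ k
  EU-deg plus  zero    e       = e
  EU-deg plus  (suc k) (e , _) = e
  EU-deg minus zero    e       = e
  EU-deg minus (suc k) (e , _) = e

  EU-head : ∀ c k {φ d s} → EU c k φ → (d ∷ s) ∈ Alt φ → length (d ∷ s) ≡ k → d ≡ c
  EU-head c     zero    _         _  ()
  EU-head plus  (suc k) (_ , top) s∈ eq = just-injective (top _ s∈ eq)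
  EU-head minus (suc k) (_ , top) s∈ eq = just-injective (top _ s∈ eq)

  Alt-fits : ∀ {c k φ} → (∀ {s} → s ∈ Alt φ → length s ≤ k)
           → (∀ {d s} → (d ∷ s) ∈ Alt φ → length (d ∷ s) ≡ k → d ≡ c)
           → All (Fits c k) (Alt φ)
  Alt-fits {c} {k} {φ} short top = All.tabulate fits
    where
    fits : ∀ {s} → s ∈ Alt φ → Fits c k s
    fits {[]}    _  = nil
    fits {_ ∷ _} s∈ = Fits-bounded (lookup (Alt-alternating φ) s∈) (short s∈) (top s∈)

  EU⁺⇒fits : ∀ c {k φ} → EU⁺ c k φ → All (Fits c k) (Alt φ)
  EU⁺⇒fits c {k} {φ} (inj₁ e) = Alt-fits {φ = φ} (λ s∈ → subst (_ ≤_) (EU-deg c k e) (∈⇒length≤max s∈)) (EU-head c k e)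
  EU⁺⇒fits c {φ = φ} (inj₂ (_ , deg<k , refl)) =
    Alt-fits {φ = φ} (λ s∈ → ≤-trans (∈⇒length≤max s∈) (<⇒≤ deg<k))
             (λ s∈ eq → ⊥-elim (<-irrefl eq (≤-<-trans (∈⇒length≤max s∈) deg<k)))

  PNF-in-Class⁺ : ∀ c {k φ} → EU⁺ c k φ → ∃[ ψ ] (ψ ∈PNF φ × Class⁺ c k ψ)
  PNF-in-Class⁺ c {φ = φ} e with fits⇒PrenexForm φ (EU⁺⇒fits c e)
  ... | prenexForm ψ _ r P f = ψ , (r , HasPrefix⇒Prenex P) , HasPrefix⇒Class⁺ P f

theorem4p3 : (L : Signature) → let open FOL L in
    (k : ℕ) (φ : Formula) →
    (E⁺ k φ → ∃[ ψ ] (ψ ∈PNF φ × Σ⁺ k ψ))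
    × (U⁺ k φ → ∃[ ψ ] (ψ ∈PNF φ × Π⁺ k ψ))
theorem4p3 L k φ = PNF-in-Class⁺ plus , PNF-in-Class⁺ minus
  where open PrenexNormalForm L
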